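{- The logics $\mathcal{PP}^{\rhd,\Rightarrow_H}_{\le}$ (Set-Set) and $\mathcal{PP}^{\Rightarrow_H}_{\le}$ (Set-Fmla) are determined by the class of matrices $\{\langle\mathbf{PP}_6^{\Rightarrow_H},{\uparrow}\mathbf f\rangle,\langle\mathbf{PP}_6^{\Rightarrow_H},{\uparrow}\mathbf b\rangle,\langle\mathbf{PP}_6^{\Rightarrow_H},{\uparrow}\hat{\mathbf t}\rangle\}$. Moreover, all these matrices are reduced.
   Context: Let $\mathcal{V}_6=\{\hat{\mathbf f},\mathbf f,\mathbf n,\mathbf b,\mathbf t,\hat{\mathbf t}\}$, partially ordered as a bounded distributive lattice by $\hat{\mathbf f}<\mathbf f<\mathbf n<\mathbf t<\hat{\mathbf t}$ and $\mathbf f<\mathbf b<\mathbf t$, with $\mathbf n,\mathbf b$ incomparable. $\mathbf{PP}_6$ is the algebra on $\mathcal V_6$ in the signature $\{\land,\lor,{\sim},\circ,\bot,\top\}$ where $\land,\lor$ are meet and join, $\bot=\hat{\mathbf f}$, $\top=\hat{\mathbf t}$, ${\sim}$ swaps $\mathbf f\leftrightarrow\mathbf t$ and $\hat{\mathbf f}\leftrightarrow\hat{\mathbf t}$ and fixes $\mathbf n,\mathbf b$, and ${\circ}a=\hat{\mathbf t}$ if $a\in\{\hat{\mathbf f},\hat{\mathbf t}\}$, ${\circ}a=\hat{\mathbf f}$ otherwise. $\mathbf{PP}_6^{\Rightarrow_H}$ expands $\mathbf{PP}_6$ by $a\Rightarrow b=\max\{c: a\land c\le b\}$. ${\uparrow}a=\{c\in\mathcal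 V_6: a\le c\}$. For a class $\mathsf K$ of algebras with bounded distributive lattice reduct, $\Phi\rhd^{\le}_{\mathsf K}\Psi$ iff for some finite $\Phi'\subseteq\Phi$, $\Psi'\subseteq\Psi$, $\bigwedge\Phi'\le\bigvee\Psi'$ is valid in $\mathsf K$ ($\bigwedge\varnothing=\top$, $\bigvee\varnothing=\bot$), and $\Phi\vdash^{\le}_{\mathsf K}\psi$ iff $\Phi\rhd^{\le}_{\mathsf K}\{\psi\}$. $\mathcal{PP}^{\rhd,\Rightarrow_H}_{\le}$ and $\mathcal{PP}^{\Rightarrow_H}_{\le}$ are these logics for $\mathsf K=\mathbb V(\mathbf{PP}_6^{\Rightarrow_H})$, the variety generated by $\mathbf{PP}_6^{\Rightarrow_H}$. The Set-Set (resp. Set-Fmla) logic determined by a class $\mathcal M$ of matrices $\langle\mathbf A,D\rangle$: $\Phi\rhd\Psi$ iff for every matrix in $\mathcal M$ and homomorphism $h$ from formulas to $\mathbf A$, $h(\varphi)\notin D$ for some $\varphi\in\Phi$ or $h(\psi)\in D$ for some $\psi\in\Psi$ (resp. $\Phi\vdash\psi$ iff $\Phi\rhd\{\psi\}$). A matrix $\langle\mathbf A,D\rangle$ is reduced if its Leibniz congruence (the largest congruence $\theta$ of $\mathbf A$ such that $a\in D$ and $a\,\theta\, b$ imply $b\in D$) is the identity. -}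

module Defs where

open import Data.Nat using (ℕ; zero; suc; _<ᵇ_)
open import Data.Bool using (Bool; true; false; if_then_else_; _∧_; _∨_; not; T)
open import Data.List using (List; []; _∷_; foldr)
open import Data.List.Relation.Unary.All using (All)
open import Data.Product using (Σ; _×_)
open import Data.Sum using (_⊎_)
open import Relation.Nullary using (¬_)
open import Relation.Binary.PropositionalEquality using (_≡_; refl)

data V6 : Set where
  f̂ f n b t t̂ : V6

level : V6 → ℕ
level f̂ = 0
level f = 1
level n = 2
level b = 2
level t = 3
level t̂ = 4

_≟ᵇ_ : V6 → V6 → Bool
f̂ ≟ᵇ f̂ = true
f ≟ᵇ f = true
n ≟ᵇ n = true
b ≟ᵇ b = true
t ≟ᵇ t = true
t̂ ≟ᵇ t̂ = true
_ ≟ᵇ _ = false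

-- the partial order: f̂<f<n<t<t̂, f<b<t, n and b incomparable
_≤ᵇ_ : V6 → V6 → Bool
x ≤ᵇ y = (x ≟ᵇ y) ∨ (level x <ᵇ level y)

_≤_ : V6 → V6 → Set
x ≤ y = T (x ≤ᵇ y)

-- meet and join (the only incomparable pair is {n , b}, with meet f and join t)
meet : V6 → V6 → V6
meet x y = if x ≤ᵇ y then x else (if y ≤ᵇ x then y else f)

join : V6 → V6 → V6
join x y = if x ≤ᵇ y then y else (if y ≤ᵇ x then x else t)

elems : List V6
elems = f̂ ∷ f ∷ n ∷ b ∷ t ∷ t̂ ∷ []

allV : (V6 → Bool) → Bool
allV p = foldr (λ x r → p x ∧ r) true elems

_⇒ᵇ_ : Bool → Bool → Bool
p ⇒ᵇ q = not p ∨ q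

meet-glb : allV (λ x → allV (λ y → allV (λ z →
  (meet x y ≤ᵇ x) ∧ (meet x y ≤ᵇ y) ∧ (((z ≤ᵇ x) ∧ (z ≤ᵇ y)) ⇒ᵇ (z ≤ᵇ meet x y))))) ≡ true
meet-glb = refl

join-lub : allV (λ x → allV (λ y → allV (λ z →
  (x ≤ᵇ join x y) ∧ (y ≤ᵇ join x y) ∧ (((x ≤ᵇ z) ∧ (y ≤ᵇ z)) ⇒ᵇ (join x y ≤ᵇ z))))) ≡ true
join-lub = refl

-- Heyting implication  a ⇒ b = max { c : a ∧ c ≤ b }:
-- the first element c, scanning from the top, with a ∧ c ≤ b
firstFrom : List V6 → (V6 → Bool) → V6
firstFrom [] p = f̂
firstFrom (c ∷ cs) p = if p c then c else firstFrom cs p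

imp : V6 → V6 → V6
imp x y = firstFrom (t̂ ∷ t ∷ n ∷ b ∷ f ∷ f̂ ∷ []) (λ c → meet x c ≤ᵇ y)

imp-max : allV (λ x → allV (λ y → allV (λ z →
  (meet x (imp x y) ≤ᵇ y) ∧ ((meet x z ≤ᵇ y) ⇒ᵇ (z ≤ᵇ imp x y))))) ≡ true
imp-max = refl

neg : V6 → V6
neg f̂ = t̂
neg f = t
neg n = n
neg b = b
neg t = f
neg t̂ = f̂

circ : V6 → V6
circ f̂ = t̂
circ t̂ = t̂
circ _ = f̂

data Fm : Set where
  var  : ℕ → Fm
  _∧'_ : Fm → Fm → Fm
  _∨'_ : Fm → Fm → Fm
  ~_   : Fm → Fm
  ∘_   : Fm → Fm
  ⊥'   : Fm
  ⊤'   : Fm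
  _⇒'_ : Fm → Fm → Fm

record Alg : Set₁ where
  field
    Carrier : Set
    _⊓_ _⊔_ _↝_ : Carrier → Carrier → Carrier
    ¬ₐ ∘ₐ : Carrier → Carrier
    botₐ topₐ : Carrier

eval : (A : Alg) → (ℕ → Alg.Carrier A) → Fm → Alg.Carrier A
eval A v (var i) = v i
eval A v (φ ∧' ψ) = Alg._⊓_ A (eval A v φ) (eval A v ψ)
eval A v (φ ∨' ψ) = Alg._⊔_ A (eval A v φ) (eval A v ψ)
eval A v (~ φ) = Alg.¬ₐ A (eval A v φ)
eval A v (∘ φ) = Alg.∘ₐ A (eval A v φ)
eval A v ⊥' = Alg.botₐ A
eval A v ⊤' = Alg.topₐ A
eval A v (φ ⇒' ψ) = Alg._↝_ A (eval A v φ) (eval A v ψ)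

PP6H : Alg
PP6H = record
  { Carrier = V6 ; _⊓_ = meet ; _⊔_ = join ; _↝_ = imp
  ; ¬ₐ = neg ; ∘ₐ = circ ; botₐ = f̂ ; topₐ = t̂ }

ValidEq : Alg → Fm → Fm → Set
ValidEq A s u = ∀ (v : ℕ → Alg.Carrier A) → eval A v s ≡ eval A v u

-- V(PP6^{⇒H}) = HSP(PP6^{⇒H}) = Mod(Id(PP6^{⇒H})) (Birkhoff):
-- the algebras satisfying every equation valid in PP6^{⇒H}
InVariety : Alg → Set
InVariety B = ∀ s u → ValidEq PP6H s u → ValidEq B s u

-- the inequation φ ≤ ψ (i.e. the equation φ ∧ ψ ≈ φ) is valid in the variety
ValidLeq : Fm → Fm → Set₁
ValidLeq φ ψ = ∀ (B : Alg) → InVariety B → ValidEq B (φ ∧' ψ) φ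

⋀ : List Fm → Fm
⋀ = foldr _∧'_ ⊤'

⋁ : List Fm → Fm
⋁ = foldr _∨'_ ⊥'

-- sets of formulas are predicates; finite subsets are lists of members
-- Φ ▷≤ Ψ  (the logic PP^{▷,⇒H}_≤)
_▷≤_ : (Fm → Set) → (Fm → Set) → Set₁
Φ ▷≤ Ψ = Σ (List Fm) λ Φ' → Σ (List Fm) λ Ψ' →
  All Φ Φ' × All Ψ Ψ' × ValidLeq (⋀ Φ') (⋁ Ψ')

_⊢≤_ : (Fm → Set) → Fm → Set₁
Φ ⊢≤ ψ = Φ ▷≤ (λ χ → χ ≡ ψ)

↑ : V6 → V6 → Set
↑ a c = a ≤ c

data MIdx : Set where
  m-f m-b m-t̂ : MIdx

D : MIdx → V6 → Set
D m-f = ↑ f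
D m-b = ↑ b
D m-t̂ = ↑ t̂

_▷M_ : (Fm → Set) → (Fm → Set) → Set
Φ ▷M Ψ = ∀ (i : MIdx) (h : ℕ → V6) →
  (Σ Fm λ φ → Φ φ × ¬ D i (eval PP6H h φ)) ⊎ (Σ Fm λ ψ → Ψ ψ × D i (eval PP6H h ψ))

_⊢M_ : (Fm → Set) → Fm → Set
Φ ⊢M ψ = Φ ▷M (λ χ → χ ≡ ψ)

record IsCongruence (θ : V6 → V6 → Set) : Set where
  field
    refl-θ  : ∀ x → θ x x
    sym-θ   : ∀ {x y} → θ x y → θ y x
    trans-θ : ∀ {x y z} → θ x y → θ y z → θ x z
    meet-θ  : ∀ {x x' y y'} → θ x x' → θ y y' → θ (meet x y) (meet x' y')
    join-θ  : ∀ {x x' y y'} → θ x x' → θ y y' → θ (join x y) (join x' y')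
    imp-θ   : ∀ {x x' y y'} → θ x x' → θ y y' → θ (imp x y) (imp x' y')
    neg-θ   : ∀ {x x'} → θ x x' → θ (neg x) (neg x')
    circ-θ  : ∀ {x x'} → θ x x' → θ (circ x) (circ x')

Compatible : (V6 → V6 → Set) → (V6 → Set) → Set
Compatible θ Dₛ = ∀ {x y} → Dₛ x → θ x y → Dₛ y

-- ⟨PP6^{⇒H}, Dₛ⟩ is reduced: its Leibniz congruence (the largest congruence
-- compatible with Dₛ) is the identity, i.e. every compatible congruence is
-- contained in the identity relation
Reduced : (V6 → Set) → Set₁
Reduced Dₛ = ∀ (θ : V6 → V6 → Set) → IsCongruence θ → Compatible θ Dₛ →
  ∀ x y → θ x y → x ≡ y

{-# OPTIONS --safe #-}
-- Each designated set ↑f, ↑b, ↑t̂ is a prime filter of PP6H, so an inequation ⋀Φ' ≤ ⋁Ψ' valid in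
-- PP6H forces some φ ∈ Φ' to be undesignated or some ψ ∈ Ψ' to be designated. Conversely, if
-- ⋀Φ' ≰ ⋁Ψ' at some valuation, some ↑d with d join-irreducible contains the first value but not
-- the second; the one case not among the matrices, d = n, is moved onto ↑b by the automorphism of
-- PP6H exchanging n and b. Arbitrary Φ, Ψ reduce to finite ones by compactness of finite matrices,
-- a König-style argument on valuations ℕ → V6 that uses excluded middle. For reducedness, the term
-- ∘(x ⇒ y) ∧ (x ⇒ y) is t̂ if x ≤ y and f̂ otherwise, so a congruence relating x ≰ y relates t̂ to f̂.
module Submission where

open import Defs
open import Level using (0ℓ)
open import Axiom.ExcludedMiddle using (ExcludedMiddle)
open import Axiom.DoubleNegationElimination using (em⇒dne)
open import Data.Bool using (Bool; true; false; T; _∧_; _∨_; not)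
open import Data.Bool.Properties using (T-∧; T-∨; T-≡)
open import Data.Empty using (⊥-elim)
open import Data.Unit using (tt)
open import Data.List using (List; []; _∷_; _++_; [_]; map; foldr)
open import Data.Bool.ListAction using (all; any)
open import Data.List.Membership.Propositional using (_∈_; lose)
open import Data.List.Relation.Unary.All as All using (All; []; _∷_; lookupAny)
open import Data.List.Relation.Unary.All.Properties using (++⁺; ++⁻ˡ; ++⁻ʳ; all⁺; map⁺; map⁻; ¬Any⇒All¬; ¬All⇒Any¬)
open import Data.List.Relation.Unary.Any as Any using (Any; here; there; satisfied)
open import Data.List.Relation.Unary.Any.Properties using (any⁻)
open import Data.Nat using (ℕ; zero; suc; _<_; _+_; _≡ᵇ_; s≤s⁻¹)
open import Data.Nat.Properties using (_≟_; ≡ᵇ⇒≡; ≤∧≢⇒<; <-≤-trans; m≤m+n; m≤n+m; n<1+n)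
open import Data.Product using (Σ; _×_; _,_; proj₁; proj₂)
open import Data.Sum using (_⊎_; inj₁; inj₂; [_,_]′)
open import Function using (_∘_; const)
open import Function.Bundles using (_⇔_; mk⇔; Equivalence)
open import Relation.Nullary using (¬_; Dec; yes; no)
open import Relation.Nullary.Decidable using (T?; decidable-stable)
open import Relation.Binary.PropositionalEquality using (_≡_; _≢_; refl; sym; trans; cong; cong₂; subst)

open Equivalence using (to; from)

record IsEndomorphism (A : Alg) (s : Alg.Carrier A → Alg.Carrier A) : Set where
  open Alg A
  field
    ⊓-hom : ∀ x y → s (x ⊓ y) ≡ s x ⊓ s y
    ⊔-hom : ∀ x y → s (x ⊔ y) ≡ s x ⊔ s y
    ↝-hom : ∀ x y → s (x ↝ y) ≡ s x ↝ s y
    ¬-hom : ∀ x → s (¬ₐ x) ≡ ¬ₐ (s x)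
    ∘-hom : ∀ x → s (∘ₐ x) ≡ ∘ₐ (s x)
    bot-hom : s botₐ ≡ botₐ
    top-hom : s topₐ ≡ topₐ

eval-endomorphism : ∀ {A s} → IsEndomorphism A s → ∀ h φ → eval A (s ∘ h) φ ≡ s (eval A h φ)
eval-endomorphism {A} {s} endo h = go
  where
    open Alg A
    open IsEndomorphism endo
    go : ∀ φ → eval A (s ∘ h) φ ≡ s (eval A h φ)
    go (var i) = refl
    go (φ ∧' ψ) = trans (cong₂ _⊓_ (go φ) (go ψ)) (sym (⊓-hom _ _))
    go (φ ∨' ψ) = trans (cong₂ _⊔_ (go φ) (go ψ)) (sym (⊔-hom _ _))
    go (~ φ) = trans (cong ¬ₐ (go φ)) (sym (¬-hom _))
    go (∘ φ) = trans (cong ∘ₐ (go φ)) (sym (∘-hom _))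
    go ⊥' = sym bot-hom
    go ⊤' = sym top-hom
    go (φ ⇒' ψ) = trans (cong₂ _↝_ (go φ) (go ψ)) (sym (↝-hom _ _))

Agree : {C : Set} → ℕ → (ℕ → C) → (ℕ → C) → Set
Agree k g h = ∀ {j} → j < k → g j ≡ h j

Agree-+ˡ : ∀ {C : Set} {k l} {g h : ℕ → C} → Agree (k + l) g h → Agree k g h
Agree-+ˡ {k = k} {l} agree j<k = agree (<-≤-trans j<k (m≤m+n k l))

Agree-+ʳ : ∀ {C : Set} {k l} {g h : ℕ → C} → Agree (k + l) g h → Agree l g h
Agree-+ʳ {k = k} {l} agree j<l = agree (<-≤-trans j<l (m≤n+m l k))

varBound : Fm → ℕ
varBound (var i) = suc i
varBound (φ ∧' ψ) = varBound φ + varBound ψ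
varBound (φ ∨' ψ) = varBound φ + varBound ψ
varBound (~ φ) = varBound φ
varBound (∘ φ) = varBound φ
varBound ⊥' = 0
varBound ⊤' = 0
varBound (φ ⇒' ψ) = varBound φ + varBound ψ

eval-local : ∀ A φ {g h} → Agree (varBound φ) g h → eval A g φ ≡ eval A h φ
eval-local A (var i) agree = agree (n<1+n i)
eval-local A (φ ∧' ψ) agree =
  cong₂ (Alg._⊓_ A) (eval-local A φ (Agree-+ˡ agree)) (eval-local A ψ (Agree-+ʳ agree))
eval-local A (φ ∨' ψ) agree =
  cong₂ (Alg._⊔_ A) (eval-local A φ (Agree-+ˡ agree)) (eval-local A ψ (Agree-+ʳ agree))
eval-local A (~ φ) agree = cong (Alg.¬ₐ A) (eval-local A φ agree)
eval-local A (∘ φ) agree = cong (Alg.∘ₐ A) (eval-local A φ agree)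
eval-local A ⊥' agree = refl
eval-local A ⊤' agree = refl
eval-local A (φ ⇒' ψ) agree =
  cong₂ (Alg._↝_ A) (eval-local A φ (Agree-+ˡ agree)) (eval-local A ψ (Agree-+ʳ agree))

Sequent : Set
Sequent = List Fm × List Fm

_⊕_ : Sequent → Sequent → Sequent
(Γ , Δ) ⊕ (Γ′ , Δ′) = Γ ++ Γ′ , Δ ++ Δ′

⨁ : List Sequent → Sequent
⨁ = foldr _⊕_ ([] , [])

Within : (Fm → Set) → (Fm → Set) → Sequent → Set
Within Φ Ψ (Γ , Δ) = All Φ Γ × All Ψ Δ

Within-⊕ : ∀ {Φ Ψ s s′} → Within Φ Ψ s → Within Φ Ψ s′ → Within Φ Ψ (s ⊕ s′)
Within-⊕ (ΓΦ , ΔΨ) (Γ′Φ , Δ′Ψ) = ++⁺ ΓΦ Γ′Φ , ++⁺ ΔΨ Δ′Ψ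

Within-⨁ : ∀ {Φ Ψ ss} → All (Within Φ Ψ) ss → Within Φ Ψ (⨁ ss)
Within-⨁ [] = [] , []
Within-⨁ (w ∷ ws) = Within-⊕ w (Within-⨁ ws)

module _ (A : Alg) (F : Alg.Carrier A → Set) where

  Refutes : (ℕ → Alg.Carrier A) → Sequent → Set
  Refutes h (Γ , Δ) = All (λ φ → F (eval A h φ)) Γ × All (λ ψ → ¬ F (eval A h ψ)) Δ

  Refutable : Sequent → Set
  Refutable s = Σ (ℕ → Alg.Carrier A) λ h → Refutes h s

  RefutesAll : (ℕ → Alg.Carrier A) → (Fm → Set) → (Fm → Set) → Set
  RefutesAll h Φ Ψ = (∀ φ → Φ φ → F (eval A h φ)) × (∀ ψ → Ψ ψ → ¬ F (eval A h ψ))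

  Refutes-⊕⁻ : ∀ {h s s′} → Refutes h (s ⊕ s′) → Refutes h s × Refutes h s′
  Refutes-⊕⁻ {s = Γ , Δ} (Γ∈ , Δ∉) = (++⁻ˡ Γ Γ∈ , ++⁻ˡ Δ Δ∉) , (++⁻ʳ Γ Γ∈ , ++⁻ʳ Δ Δ∉)

  Refutable-⊕⁻ : ∀ {s s′} → Refutable (s ⊕ s′) → Refutable s × Refutable s′
  Refutable-⊕⁻ {s} (h , refutes) = let r , r′ = Refutes-⊕⁻ {s = s} refutes in (h , r) , (h , r′)

  Refutes-⨁⁻ : ∀ {h} ss → Refutes h (⨁ ss) → All (Refutes h) ss
  Refutes-⨁⁻ [] _ = []
  Refutes-⨁⁻ (s ∷ ss) refutes = let r , rs = Refutes-⊕⁻ {s = s} refutes in r ∷ Refutes-⨁⁻ ss rs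

-- Compactness of finite matrices

¬∀⇒∃¬ : ExcludedMiddle 0ℓ → ∀ {X : Set} {P Q : X → Set} →
  ¬ (∀ x → P x → Q x) → Σ X λ x → P x × ¬ Q x
¬∀⇒∃¬ em ¬∀ = em⇒dne em λ ¬∃ → ¬∀ λ x Px → em⇒dne em λ ¬Qx → ¬∃ (x , Px , ¬Qx)

_[_≔_] : {C : Set} → (ℕ → C) → ℕ → C → ℕ → C
(g [ k ≔ c ]) j with j ≟ k
... | yes _ = c
... | no _ = g j

≔-≢ : ∀ {C : Set} {g : ℕ → C} {k c j} → j ≢ k → (g [ k ≔ c ]) j ≡ g j
≔-≢ {k = k} {j = j} j≢k with j ≟ k
... | yes j≡k = ⊥-elim (j≢k j≡k)
... | no _ = refl

<-suc-≢ : ∀ {j k} → j < suc k → j ≢ k → j < k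
<-suc-≢ j<1+k = ≤∧≢⇒< (s≤s⁻¹ j<1+k)

Agree-≔ : ∀ {C : Set} {k} {g h : ℕ → C} → Agree k g h → Agree (suc k) (g [ k ≔ h k ]) h
Agree-≔ {k = k} agree {j} j<1+k with j ≟ k
... | yes refl = refl
... | no j≢k = agree (<-suc-≢ j<1+k j≢k)

module FiniteMatrix (em : ExcludedMiddle 0ℓ) (A : Alg) {elements : List (Alg.Carrier A)}
  (elements-complete : ∀ a → a ∈ elements) (F : Alg.Carrier A → Set) {Φ Ψ : Fm → Set} where

  open Alg A using (Carrier)

  Extendable : ℕ → (ℕ → Carrier) → Set
  Extendable k g = ∀ s → Within Φ Ψ s → Σ (ℕ → Carrier) λ h → Agree k g h × Refutes A F h s

  extend : ∀ {k g} → Extendable k g → Σ Carrier λ c → Extendable (suc k) (g [ k ≔ c ])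
  extend {k} {g} extendable = em⇒dne em λ stuck →
    let obstruction : ∀ c → Σ Sequent λ s → Within Φ Ψ s ×
                        ¬ Σ (ℕ → Carrier) λ h → Agree (suc k) (g [ k ≔ c ]) h × Refutes A F h s
        obstruction c = ¬∀⇒∃¬ em λ e → stuck (c , e)
        obstructions = map (proj₁ ∘ obstruction) elements
        h , agree , refutes = extendable (⨁ obstructions)
          (Within-⨁ (map⁺ {xs = elements} (All.tabulate λ {c} _ → proj₁ (proj₂ (obstruction c)))))
        refutes-each = map⁻ (Refutes-⨁⁻ A F obstructions refutes)
    -- h refutes every obstruction and agrees with g [ k ≔ h k ] below suc k, so the obstruction
    -- for h k is refuted after all.
    in proj₂ (proj₂ (obstruction (h k)))
         (h , Agree-≔ agree , All.lookup refutes-each (elements-complete (h k)))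

  compactness : (∀ s → Within Φ Ψ s → Refutable A F s) → Σ (ℕ → Carrier) λ h → RefutesAll A F h Φ Ψ
  compactness refutable = limit , designated , undesignated
    where
      approx : ∀ k → Σ (ℕ → Carrier) (Extendable k)
      approx zero = proj₁ (refutable ([] , []) ([] , [])) ,
        λ s w → proj₁ (refutable s w) , (λ ()) , proj₂ (refutable s w)
      approx (suc k) = let g , e = approx k ; c , e′ = extend e in g [ k ≔ c ] , e′

      limit : ℕ → Carrier
      limit j = proj₁ (approx (suc j)) j

      approx-limit : ∀ k → Agree k (proj₁ (approx k)) limit
      approx-limit (suc k) {j} j<1+k = by-cases (j ≟ k)
        where
          by-cases : Dec (j ≡ k) → proj₁ (approx (suc k)) j ≡ limit j
          by-cases (yes refl) = refl
          by-cases (no j≢k) = trans (≔-≢ j≢k) (approx-limit k (<-suc-≢ j<1+k j≢k))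

      transfer : ∀ χ {h} → Agree (varBound χ) (proj₁ (approx (varBound χ))) h → eval A h χ ≡ eval A limit χ
      transfer χ agree = eval-local A χ λ j< → trans (sym (agree j<)) (approx-limit _ j<)

      designated : ∀ φ → Φ φ → F (eval A limit φ)
      designated φ Φφ with proj₂ (approx (varBound φ)) ([ φ ] , []) (Φφ ∷ [] , [])
      ... | _ , agree , (φ∈ ∷ []) , [] = subst F (transfer φ agree) φ∈

      undesignated : ∀ ψ → Ψ ψ → ¬ F (eval A limit ψ)
      undesignated ψ Ψψ with proj₂ (approx (varBound ψ)) ([] , [ ψ ]) ([] , Ψψ ∷ [])
      ... | _ , agree , [] , (ψ∉ ∷ []) = ψ∉ ∘ subst F (sym (transfer ψ agree))

one-refutes-every-part : ExcludedMiddle 0ℓ → ∀ {I : Set} A (F : I → Alg.Carrier A → Set) {Φ Ψ} is →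
  (∀ s → Within Φ Ψ s → Any (λ i → Refutable A (F i) s) is) →
  Any (λ i → ∀ s → Within Φ Ψ s → Refutable A (F i) s) is
one-refutes-every-part em A F [] refutable with refutable ([] , []) ([] , [])
... | ()
one-refutes-every-part em A F {Φ} {Ψ} (i ∷ is) refutable with em {∀ s → Within Φ Ψ s → Refutable A (F i) s}
... | yes by-i = here by-i
... | no ¬by-i = there (one-refutes-every-part em A F is λ s w →
        let s₀ , w₀ , s₀-unrefutable = ¬∀⇒∃¬ em ¬by-i
        in by-rest s₀ s₀-unrefutable (refutable (s₀ ⊕ s) (Within-⊕ w₀ w)))
  where
    by-rest : ∀ s₀ {s} → ¬ Refutable A (F i) s₀ →
      Any (λ j → Refutable A (F j) (s₀ ⊕ s)) (i ∷ is) → Any (λ j → Refutable A (F j) s) is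
    by-rest s₀ s₀-unrefutable (here r) = ⊥-elim (s₀-unrefutable (proj₁ (Refutable-⊕⁻ A (F i) {s = s₀} r)))
    by-rest s₀ _ (there rest) = Any.map (λ {j} → proj₂ ∘ Refutable-⊕⁻ A (F j) {s = s₀}) rest

elems-complete : ∀ x → x ∈ elems
elems-complete f̂ = here refl
elems-complete f = there (here refl)
elems-complete n = there (there (here refl))
elems-complete b = there (there (there (here refl)))
elems-complete t = there (there (there (there (here refl))))
elems-complete t̂ = there (there (there (there (there (here refl)))))

decide₁ : (p : V6 → Bool) → T (all p elems) → ∀ x → T (p x)
decide₁ p holds x = All.lookup (all⁺ p elems holds) (elems-complete x)

decide₂ : (p : V6 → V6 → Bool) → T (all (λ x → all (p x) elems) elems) → ∀ x y → T (p x y)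
decide₂ p holds x = decide₁ (p x) (decide₁ (λ x → all (p x) elems) holds x)

decide₃ : (p : V6 → V6 → V6 → Bool) →
  T (all (λ x → all (λ y → all (p x y) elems) elems) elems) → ∀ x y z → T (p x y z)
decide₃ p holds x = decide₂ (p x) (decide₁ (λ x → all (λ y → all (p x y) elems) elems) holds x)

modus-ponens : ∀ {p q} → T (p ⇒ᵇ q) → T p → T q
modus-ponens {true} q _ = q

T-not : ∀ {p} → T (not p) ⇔ (¬ T p)
T-not {true} = mk⇔ (λ ()) (λ ¬t → ¬t tt)
T-not {false} = mk⇔ (λ _ ()) (const _)

index : V6 → ℕ
index f̂ = 0
index f = 1
index n = 2
index b = 3
index t = 4
index t̂ = 5

fromIndex : ℕ → V6
fromIndex 0 = f̂
fromIndex 1 = f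
fromIndex 2 = n
fromIndex 3 = b
fromIndex 4 = t
fromIndex _ = t̂

fromIndex-index : ∀ x → fromIndex (index x) ≡ x
fromIndex-index f̂ = refl
fromIndex-index f = refl
fromIndex-index n = refl
fromIndex-index b = refl
fromIndex-index t = refl
fromIndex-index t̂ = refl

_==_ : V6 → V6 → Bool
x == y = index x ≡ᵇ index y

==-sound : ∀ {x y} → T (x == y) → x ≡ y
==-sound {x} {y} eq = trans (sym (fromIndex-index x))
  (trans (cong fromIndex (≡ᵇ⇒≡ (index x) (index y) eq)) (fromIndex-index y))

-- The lattice V6 and its prime filters

≤-antisym : ∀ x y → x ≤ y → y ≤ x → x ≡ y
≤-antisym x y x≤y y≤x = ==-sound
  (modus-ponens (decide₂ (λ x y → ((x ≤ᵇ y) ∧ (y ≤ᵇ x)) ⇒ᵇ (x == y)) tt x y) (from T-∧ (x≤y , y≤x)))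

meet-absorb : ∀ x y → x ≤ y → meet x y ≡ x
meet-absorb x y x≤y rewrite to T-≡ x≤y = refl

joinIrreducibleᵇ : V6 → Bool
joinIrreducibleᵇ f = true
joinIrreducibleᵇ n = true
joinIrreducibleᵇ b = true
joinIrreducibleᵇ t̂ = true
joinIrreducibleᵇ _ = false

JoinIrreducible : V6 → Set
JoinIrreducible d = T (joinIrreducibleᵇ d)

separation : ∀ x y → ¬ x ≤ y → Σ V6 λ d → JoinIrreducible d × d ≤ x × ¬ d ≤ y
separation x y x≰y =
  let d , d-separates = satisfied (any⁻ (separates x y) elems (modus-ponens
        (decide₂ (λ x y → not (x ≤ᵇ y) ⇒ᵇ any (separates x y) elems) tt x y) (from T-not x≰y)))
      ji , rest = to T-∧ d-separates
      d≤x , d≰y = to T-∧ rest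
  in d , ji , d≤x , to T-not d≰y
  where
    separates : V6 → V6 → V6 → Bool
    separates x y d = joinIrreducibleᵇ d ∧ (d ≤ᵇ x) ∧ not (d ≤ᵇ y)

record IsPrimeFilter (F : V6 → Set) : Set where
  field
    ∈? : ∀ x → Dec (F x)
    t̂∈ : F t̂
    f̂∉ : ¬ F f̂
    meet-∈ : ∀ x y → F (meet x y) ⇔ (F x × F y)
    join-∈ : ∀ x y → F (join x y) ⇔ (F x ⊎ F y)

↑-isPrimeFilter : ∀ {d} → JoinIrreducible d → IsPrimeFilter (↑ d)
↑-isPrimeFilter {d} ji = record
  { ∈? = λ x → T? (d ≤ᵇ x)
  ; t̂∈ = decide₁ (λ d → d ≤ᵇ t̂) tt d
  ; f̂∉ = to T-not (modus-ponens (decide₁ (λ d → joinIrreducibleᵇ d ⇒ᵇ not (d ≤ᵇ f̂)) tt d) ji)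
  ; meet-∈ = λ x y → mk⇔
      (to T-∧ ∘ modus-ponens (decide₃ (λ d x y → (d ≤ᵇ meet x y) ⇒ᵇ ((d ≤ᵇ x) ∧ (d ≤ᵇ y))) tt d x y))
      (modus-ponens (decide₃ (λ d x y → ((d ≤ᵇ x) ∧ (d ≤ᵇ y)) ⇒ᵇ (d ≤ᵇ meet x y)) tt d x y) ∘ from T-∧)
  ; join-∈ = λ x y → mk⇔
      (λ d≤x⊔y → to T-∨ (modus-ponens (decide₃ (λ d x y →
         (joinIrreducibleᵇ d ∧ (d ≤ᵇ join x y)) ⇒ᵇ ((d ≤ᵇ x) ∨ (d ≤ᵇ y))) tt d x y) (from T-∧ (ji , d≤x⊔y))))
      (modus-ponens (decide₃ (λ d x y → ((d ≤ᵇ x) ∨ (d ≤ᵇ y)) ⇒ᵇ (d ≤ᵇ join x y)) tt d x y) ∘ from T-∨)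
  }

swap : V6 → V6
swap n = b
swap b = n
swap x = x

swap-isEndomorphism : IsEndomorphism PP6H swap
swap-isEndomorphism = record
  { ⊓-hom = λ x y → ==-sound (decide₂ (λ x y → swap (meet x y) == meet (swap x) (swap y)) tt x y)
  ; ⊔-hom = λ x y → ==-sound (decide₂ (λ x y → swap (join x y) == join (swap x) (swap y)) tt x y)
  ; ↝-hom = λ x y → ==-sound (decide₂ (λ x y → swap (imp x y) == imp (swap x) (swap y)) tt x y)
  ; ¬-hom = λ x → ==-sound (decide₁ (λ x → swap (neg x) == neg (swap x)) tt x)
  ; ∘-hom = λ x → ==-sound (decide₁ (λ x → swap (circ x) == circ (swap x)) tt x)
  ; bot-hom = refl
  ; top-hom = refl
  }

↑n⇔↑b-swap : ∀ x → n ≤ x ⇔ b ≤ swap x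
↑n⇔↑b-swap x = mk⇔
  (modus-ponens (decide₁ (λ x → (n ≤ᵇ x) ⇒ᵇ (b ≤ᵇ swap x)) tt x))
  (modus-ponens (decide₁ (λ x → (b ≤ᵇ swap x) ⇒ᵇ (n ≤ᵇ x)) tt x))

-- Soundness and completeness

ev : (ℕ → V6) → Fm → V6
ev = eval PP6H

PP6H-inVariety : InVariety PP6H
PP6H-inVariety _ _ valid = valid

module _ {F : V6 → Set} (F-prime : IsPrimeFilter F) where
  open IsPrimeFilter F-prime

  ⋀-∈ : ∀ h Γ → F (ev h (⋀ Γ)) ⇔ All (F ∘ ev h) Γ
  ⋀-∈ h [] = mk⇔ (const []) (const t̂∈)
  ⋀-∈ h (φ ∷ Γ) = mk⇔
    (λ ∧∈ → proj₁ (to ∧-∈ ∧∈) ∷ to (⋀-∈ h Γ) (proj₂ (to ∧-∈ ∧∈)))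
    (λ { (φ∈ ∷ Γ∈) → from ∧-∈ (φ∈ , from (⋀-∈ h Γ) Γ∈) })
    where ∧-∈ = meet-∈ (ev h φ) (ev h (⋀ Γ))

  ⋁-∈ : ∀ h Δ → F (ev h (⋁ Δ)) ⇔ Any (F ∘ ev h) Δ
  ⋁-∈ h [] = mk⇔ (⊥-elim ∘ f̂∉) (λ ())
  ⋁-∈ h (ψ ∷ Δ) = mk⇔
    ([ here , there ∘ to (⋁-∈ h Δ) ]′ ∘ to ∨-∈)
    (λ { (here ψ∈) → from ∨-∈ (inj₁ ψ∈) ; (there Δ∈) → from ∨-∈ (inj₂ (from (⋁-∈ h Δ) Δ∈)) })
    where ∨-∈ = join-∈ (ev h ψ) (ev h (⋁ Δ))

  ▷≤-sound : ∀ {Φ Ψ} → Φ ▷≤ Ψ → ∀ h →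
    (Σ Fm λ φ → Φ φ × ¬ F (ev h φ)) ⊎ (Σ Fm λ ψ → Ψ ψ × F (ev h ψ))
  ▷≤-sound (Γ , Δ , ΓΦ , ΔΨ , Γ≤Δ) h with ∈? (ev h (⋀ Γ))
  ... | no ⋀Γ∉ = inj₁ (_ , lookupAny ΓΦ (¬All⇒Any¬ (∈? ∘ ev h) Γ (⋀Γ∉ ∘ from (⋀-∈ h Γ))))
  ... | yes ⋀Γ∈ = inj₂ (_ , lookupAny ΔΨ (to (⋁-∈ h Δ) ⋁Δ∈))
    where
      ⋁Δ∈ : F (ev h (⋁ Δ))
      ⋁Δ∈ = proj₂ (to (meet-∈ (ev h (⋀ Γ)) (ev h (⋁ Δ)))
        (subst F (sym (Γ≤Δ PP6H PP6H-inVariety h)) ⋀Γ∈))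

  refutes-separated : ∀ {h Γ Δ} → F (ev h (⋀ Γ)) → ¬ F (ev h (⋁ Δ)) → Refutes PP6H F h (Γ , Δ)
  refutes-separated {h} {Γ} {Δ} ⋀Γ∈ ⋁Δ∉ = to (⋀-∈ h Γ) ⋀Γ∈ , ¬Any⇒All¬ Δ (⋁Δ∉ ∘ from (⋁-∈ h Δ))

D-isPrimeFilter : ∀ i → IsPrimeFilter (D i)
D-isPrimeFilter m-f = ↑-isPrimeFilter _
D-isPrimeFilter m-b = ↑-isPrimeFilter _
D-isPrimeFilter m-t̂ = ↑-isPrimeFilter _

separating-matrix : ∀ φ ψ v → ¬ ev v φ ≤ ev v ψ →
  Σ MIdx λ i → Σ (ℕ → V6) λ h → D i (ev h φ) × ¬ D i (ev h ψ)
separating-matrix φ ψ v φ≰ψ with separation (ev v φ) (ev v ψ) φ≰ψ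
... | f , _ , f≤φ , f≰ψ = m-f , v , f≤φ , f≰ψ
... | b , _ , b≤φ , b≰ψ = m-b , v , b≤φ , b≰ψ
... | t̂ , _ , t̂≤φ , t̂≰ψ = m-t̂ , v , t̂≤φ , t̂≰ψ
... | n , _ , n≤φ , n≰ψ = m-b , swap ∘ v ,
        subst (b ≤_) (sym (swapped φ)) (to (↑n⇔↑b-swap (ev v φ)) n≤φ) ,
        n≰ψ ∘ from (↑n⇔↑b-swap (ev v ψ)) ∘ subst (b ≤_) (swapped ψ)
  where
    swapped : ∀ χ → ev (swap ∘ v) χ ≡ swap (ev v χ)
    swapped = eval-endomorphism swap-isEndomorphism v

finite-completeness : ∀ {Γ Δ} → (∀ i h → ¬ Refutes PP6H (D i) h (Γ , Δ)) → ValidLeq (⋀ Γ) (⋁ Δ)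
finite-completeness {Γ} {Δ} unrefuted B B∈V = B∈V (⋀ Γ ∧' ⋁ Δ) (⋀ Γ) λ v →
  meet-absorb (ev v (⋀ Γ)) (ev v (⋁ Δ)) (decidable-stable (T? (ev v (⋀ Γ) ≤ᵇ ev v (⋁ Δ))) λ Γ≰Δ →
    let i , h , ⋀Γ∈ , ⋁Δ∉ = separating-matrix (⋀ Γ) (⋁ Δ) v Γ≰Δ
    in unrefuted i h (refutes-separated (D-isPrimeFilter i) ⋀Γ∈ ⋁Δ∉))

matrices : List MIdx
matrices = m-f ∷ m-b ∷ m-t̂ ∷ []

matrices-complete : ∀ i → i ∈ matrices
matrices-complete m-f = here refl
matrices-complete m-b = there (here refl)
matrices-complete m-t̂ = there (there (here refl))

matrices-compact : ExcludedMiddle 0ℓ → ∀ {Φ Ψ} →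
  (∀ s → Within Φ Ψ s → Σ MIdx λ i → Refutable PP6H (D i) s) →
  Σ MIdx λ i → Σ (ℕ → V6) λ h → RefutesAll PP6H (D i) h Φ Ψ
matrices-compact em refutable
  with satisfied (one-refutes-every-part em PP6H D matrices λ s w →
         let i , r = refutable s w in lose (matrices-complete i) r)
... | i , by-i = i , FiniteMatrix.compactness em PP6H elems-complete (D i) by-i

▷≤⇒▷M : ∀ {Φ Ψ} → Φ ▷≤ Ψ → Φ ▷M Ψ
▷≤⇒▷M consequence i = ▷≤-sound (D-isPrimeFilter i) consequence

▷M-unrefuted : ∀ {Φ Ψ} → Φ ▷M Ψ → ∀ i h → ¬ RefutesAll PP6H (D i) h Φ Ψ
▷M-unrefuted consequence i h (designated , undesignated) with consequence i h
... | inj₁ (φ , Φφ , φ∉) = φ∉ (designated φ Φφ)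
... | inj₂ (ψ , Ψψ , ψ∈) = undesignated ψ Ψψ ψ∈

▷M⇒▷≤ : ExcludedMiddle 0ℓ → ∀ {Φ Ψ} → Φ ▷M Ψ → Φ ▷≤ Ψ
▷M⇒▷≤ em {Φ} {Ψ} consequence with em {Σ Sequent λ s → Within Φ Ψ s × ∀ i h → ¬ Refutes PP6H (D i) h s}
... | yes ((Γ , Δ) , (ΓΦ , ΔΨ) , unrefuted) = Γ , Δ , ΓΦ , ΔΨ , finite-completeness unrefuted
... | no ¬unrefuted =
  let i , h , refutes = matrices-compact em λ s w →
        em⇒dne em λ ¬refutable → ¬unrefuted (s , w , λ i h r → ¬refutable (i , h , r))
  in ⊥-elim (▷M-unrefuted consequence i h refutes)

-- Reducedness

≤-test : V6 → V6 → V6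
≤-test x y = meet (circ (imp x y)) (imp x y)

≤-test-refl : ∀ x → ≤-test x x ≡ t̂
≤-test-refl x = ==-sound (decide₁ (λ x → ≤-test x x == t̂) tt x)

≤-test-≰ : ∀ x y → ¬ x ≤ y → ≤-test x y ≡ f̂
≤-test-≰ x y x≰y = ==-sound
  (modus-ponens (decide₂ (λ x y → not (x ≤ᵇ y) ⇒ᵇ (≤-test x y == f̂)) tt x y) (from T-not x≰y))

reduced : ∀ {Dₛ} → Dₛ t̂ → ¬ Dₛ f̂ → Reduced Dₛ
reduced {Dₛ} t̂∈ f̂∉ θ θ-congruence compatible x y θxy =
  ≤-antisym x y (θ⇒≤ θxy) (θ⇒≤ (sym-θ θxy))
  where
    open IsCongruence θ-congruence
    θ⇒≤ : ∀ {x y} → θ x y → x ≤ y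
    θ⇒≤ {x} {y} θxy = decidable-stable (T? (x ≤ᵇ y)) λ x≰y →
      let θ-imp = imp-θ θxy (refl-θ y)
          θ-test = meet-θ (circ-θ θ-imp) θ-imp
      in f̂∉ (subst Dₛ (≤-test-≰ x y x≰y)
               (compatible (subst Dₛ (sym (≤-test-refl y)) t̂∈) (sym-θ θ-test)))

proposition5p6 : ExcludedMiddle 0ℓ →
    ((Φ Ψ : Fm → Set) → (Φ ▷≤ Ψ → Φ ▷M Ψ) × (Φ ▷M Ψ → Φ ▷≤ Ψ))
    × ((Φ : Fm → Set) (ψ : Fm) → (Φ ⊢≤ ψ → Φ ⊢M ψ) × (Φ ⊢M ψ → Φ ⊢≤ ψ))
    × ((i : MIdx) → Reduced (D i))
proposition5p6 em =
  (λ Φ Ψ → ▷≤⇒▷M , ▷M⇒▷≤ em) ,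
  (λ Φ ψ → ▷≤⇒▷M , ▷M⇒▷≤ em) ,
  λ i → let open IsPrimeFilter (D-isPrimeFilter i) in reduced t̂∈ f̂∉
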